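{- Let $A$ be a setoid, $B$ a setoid family over $A$ and $(C,a_C)$ a $P_B$-algebra. Let $w:W$ and $k,k':\mathsf{ImS}\,w\Rightarrow C$. Then \[\mathsf{RecDef}\,w\,k\to\mathsf{RecDef}\,w\,k'\to k\approx k'.\]
   Context: Setting: intensional Martin-Löf type theory with $\Pi$-types and a universe $\mathsf{U}$ closed under $\Pi$ and containing intensional $\Sigma$-types, identity types, the unit type, W-types and dependent W-types (inductive families); logic is propositions-as-types. A setoid $X$ is a tuple $(X_0,\approx_X,r_X,s_X,t_X)$ with $X_0:\mathsf{U}$, $\approx_X:X_0\to X_0\to\mathsf{U}$ and witnesses of reflexivity, symmetry, transitivity; $x:X$ means $x:X_0$. An extensional function $f:X\Rightarrow Y$ is $f_0:X_0\to Y_0$ with a proof of $\prod_{x,x'}x\approx x'\to f_0x\approx f_0x'$; the setoid $X\Rightarrow Y$ has $f\approx g:=\prod_x f_0x\approx g_0x$. A setoid family $B$ over a setoid $A$ gives a setoid $B\,a$ (underlying type $B_0a$) for $a:A$ and extensional transports $B_\alpha:B\,a\Rightarrow B\,a'$ for $\alpha:a\approx_Aa'$, functorial up to $\approx$, with $B_\alpha\approx B_{\alpha'}$ for all $\alpha,\alpha':a\approx a'$. Write $b\approx_\alpha b'$ for $B_\alpha b\approx b'$. $P_BX$ is the setoid on $\sum_{a:A_0}(B\,a\Rightarrow X)$ with $(a,k)\approx(a',k'):=\sum_{\alpha:a\approx a'}k\approx k'\circ B_\alpha$. A $P_B$-algebra is a setoid $C$ with extensional $a_C:P_BC\Rightarrow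 C$. $\mathrm{W}$ is the W-type on $A_0,B_0$ with constructor $\mathsf{sup}$, and $\mathsf{n}(\mathsf{sup}\,a\,f)\equiv a$, $\mathsf{b}(\mathsf{sup}\,a\,f)\equiv f$. $\mathcal{W}_B$ is the inductive family on $\mathrm{W}\times\mathrm{W}$ with single constructor $\mathsf{dsup}\,(w,w')\,\alpha\,\phi:\mathcal{W}_B\,w\,w'$ for $\alpha:\mathsf{n}w\approx_A\mathsf{n}w'$ and $\phi:\prod_{(b,b',\beta):\sum_{b,b'}b\approx_\alpha b'}\mathcal{W}_B(\mathsf{b}\,w\,b)(\mathsf{b}\,w'\,b')$. The setoid $W$ has underlying type $\sum_w\mathcal{W}_B\,w\,w$ and $(w,\_)\approx_W(w',\_):=\mathcal{W}_B\,w\,w'$. For $\gamma:w\approx_Ww'$, $\mathsf{n}\triangleright\gamma:\mathsf{n}w\approx_A\mathsf{n}w'$ is its label component; each $\mathsf{b}\,w:B(\mathsf{n}w)\Rightarrow W$ is extensional. For $w:W$, $\mathsf{ImS}\,w$ is the setoid on $B_0(\mathsf{n}w)$ with $s\approx s':=\mathsf{b}\,w\,s\approx_W\mathsf{b}\,w\,s'$; for $\gamma:w\approx_Ww'$, $\mathsf{ImS}_\gamma:=B_{\mathsf{n}\triangleright\gamma}$. $e_w:B(\mathsf{n}w)\Rightarrow\mathsf{ImS}\,w$ is the identity on underlying types. $\mathsf{CohMaps}\,w$ is the setoid of families $F:\prod_{s:\mathsf{ImS}\,w}\mathsf{ImS}(\mathsf{b}\,w\,s)\Rightarrow C$ such that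 $F\,s\approx(F\,s')\circ\mathsf{ImS}_\sigma$ for all $\sigma:\mathsf{b}\,w\,s\approx_W\mathsf{b}\,w\,s'$. For $F:\mathsf{CohMaps}\,w$, $\mathsf{recst}\,w\,F:\mathsf{ImS}\,w\Rightarrow C$ is $s\mapsto a_C(\mathsf{n}(\mathsf{b}\,w\,s),(F\,s)\circ e_{\mathsf{b}ws})$. For $k:\mathsf{ImS}\,w\Rightarrow C$, $\mathsf{RecDef}\,w\,k$ is the inductive family (dependent W-type indexed by $\sum_{w:W}(\mathsf{ImS}\,w\Rightarrow C)$) with the single constructor: from $F:\mathsf{CohMaps}\,w$, a proof of $k\approx\mathsf{recst}\,w\,F$ and $\prod_{s:B_0(\mathsf{n}w)}\mathsf{RecDef}\,(\mathsf{b}\,w\,s)\,(F\,s)$, form an element of $\mathsf{RecDef}\,w\,k$. -}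

{-# OPTIONS --without-K #-}
module Defs where

open import Level using (0ℓ)
open import Relation.Binary.Bundles using (Setoid)
open import Relation.Binary.Structures using (IsEquivalence)
open import Function.Bundles using (Func)
open import Data.Product using (Σ; Σ-syntax; _,_; proj₁; proj₂)

-- Setoids are the stdlib setoids with carrier and relation in U = Set.
-- Extensional functions X ⇒ Y are 'Func X Y' (fields 'to', 'cong').

_≈→_ : {X Y : Setoid 0ℓ 0ℓ} → Func X Y → Func X Y → Set
_≈→_ {X} {Y} f g = (x : Setoid.Carrier X) → Setoid._≈_ Y (Func.to f x) (Func.to g x)

_∘F_ : {X Y Z : Setoid 0ℓ 0ℓ} → Func Y Z → Func X Y → Func X Z
g ∘F f = record { to = λ x → Func.to g (Func.to f x)
                ; cong = λ p → Func.cong g (Func.cong f p) }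

idF : {X : Setoid 0ℓ 0ℓ} → Func X X
idF = record { to = λ x → x ; cong = λ p → p }

record SetoidFamily (A : Setoid 0ℓ 0ℓ) : Set₁ where
  open Setoid A renaming (Carrier to A₀; _≈_ to _≈A_)
  field
    Fam    : A₀ → Setoid 0ℓ 0ℓ
    tr     : {a a' : A₀} → a ≈A a' → Func (Fam a) (Fam a')
    tr-id  : {a : A₀} → tr (Setoid.refl A {a}) ≈→ idF
    tr-∘   : {a a' a'' : A₀} (α : a ≈A a') (α' : a' ≈A a'') →
             tr (Setoid.trans A α α') ≈→ (tr α' ∘F tr α)
    tr-irr : {a a' : A₀} (α α' : a ≈A a') → tr α ≈→ tr α'
  B₀ : A₀ → Set
  B₀ a = Setoid.Carrier (Fam a)

  tr-back : {a a' : A₀} (α : a ≈A a') (b' : B₀ a') →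
            Setoid._≈_ (Fam a') (Func.to (tr α) (Func.to (tr (Setoid.sym A α)) b')) b'
  tr-back {a} {a'} α b' =
    Setoid.trans (Fam a') (Setoid.sym (Fam a') (tr-∘ (Setoid.sym A α) α b'))
      (Setoid.trans (Fam a') (tr-irr (Setoid.trans A (Setoid.sym A α) α) (Setoid.refl A) b')
        (tr-id b'))

  tr-loop : {a : A₀} (α : a ≈A a) (b : B₀ a) →
            Setoid._≈_ (Fam a) (Func.to (tr α) b) b
  tr-loop {a} α b = Setoid.trans (Fam a) (tr-irr α (Setoid.refl A) b) (tr-id b)

module _ {A : Setoid 0ℓ 0ℓ} (B : SetoidFamily A) (X : Setoid 0ℓ 0ℓ) where
  private
    open module A = Setoid A using () renaming (Carrier to A₀; _≈_ to _≈A_)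
    open module X = Setoid X using () renaming (Carrier to X₀; _≈_ to _≈X_)
    open SetoidFamily B

  P-Carrier : Set
  P-Carrier = Σ[ a ∈ A₀ ] Func (Fam a) X

  _≈P_ : P-Carrier → P-Carrier → Set
  (a , k) ≈P (a' , k') = Σ[ α ∈ a ≈A a' ] (k ≈→ (k' ∘F tr α))

  P : Setoid 0ℓ 0ℓ
  P = record
    { Carrier = P-Carrier
    ; _≈_ = _≈P_
    ; isEquivalence = record
      { refl = λ { {a , k} → A.refl , λ b → Func.cong k (Setoid.sym (Fam a) (tr-id b)) }
      ; sym = λ { {a , k} {a' , k'} (α , p) →
                   A.sym α , λ b' → X.trans (Func.cong k' (Setoid.sym (Fam a') (tr-back α b')))
                                          (X.sym (p (Func.to (tr (A.sym α)) b'))) }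
      ; trans = λ { {a , k} {a' , k'} {a'' , k''} (α , p) (α' , p') →
                     A.trans α α' , λ b → X.trans (p b) (X.trans (p' (Func.to (tr α) b))
                        (Func.cong k'' (Setoid.sym (Fam a'') (tr-∘ α α' b)))) }
      }
    }

module WConstruction {A : Setoid 0ℓ 0ℓ} (B : SetoidFamily A) where
  open module A = Setoid A using () renaming (Carrier to A₀; _≈_ to _≈A_)
  open SetoidFamily B

  data W₀ : Set where
    sup : (a : A₀) → (B₀ a → W₀) → W₀

  n : W₀ → A₀
  n (sup a f) = a

  b : (w : W₀) → B₀ (n w) → W₀
  b (sup a f) = f

  _≈[_]_ : {a a' : A₀} → B₀ a → a ≈A a' → B₀ a' → Set
  _≈[_]_ {a} {a'} x α x' = Setoid._≈_ (Fam a') (Func.to (tr α) x) x'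

  data 𝒲 : W₀ → W₀ → Set where
    dsup : (w w' : W₀) (α : n w ≈A n w') →
           ((t : Σ[ x ∈ B₀ (n w) ] Σ[ x' ∈ B₀ (n w') ] (x ≈[ α ] x')) →
             𝒲 (b w (proj₁ t)) (b w' (proj₁ (proj₂ t)))) →
           𝒲 w w'

  n▷ : {w w' : W₀} → 𝒲 w w' → n w ≈A n w'
  n▷ (dsup _ _ α _) = α

  𝒲-br : {w w' : W₀} (γ : 𝒲 w w') (x : B₀ (n w)) (x' : B₀ (n w')) →
         x ≈[ n▷ γ ] x' → 𝒲 (b w x) (b w' x')
  𝒲-br (dsup _ _ α φ) x x' β = φ (x , x' , β)

  𝒲-sym : {w w' : W₀} → 𝒲 w w' → 𝒲 w' w
  𝒲-sym (dsup w w' α φ) =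
    dsup w' w (A.sym α) λ t →
      𝒲-sym (φ (proj₁ (proj₂ t) , proj₁ t ,
        Setoid.trans (Fam (n w'))
          (Func.cong (tr α) (Setoid.sym (Fam (n w)) (proj₂ (proj₂ t))))
          (tr-back α (proj₁ t))))

  𝒲-trans : {w w' w'' : W₀} → 𝒲 w w' → 𝒲 w' w'' → 𝒲 w w''
  𝒲-trans (dsup w w' α φ) (dsup _ w'' α' φ') =
    dsup w w'' (A.trans α α') λ t →
      𝒲-trans (φ (proj₁ t , Func.to (tr α) (proj₁ t) , Setoid.refl (Fam (n w'))))
              (φ' (Func.to (tr α) (proj₁ t) , proj₁ (proj₂ t) ,
                   Setoid.trans (Fam (n w'')) (Setoid.sym (Fam (n w'')) (tr-∘ α α' (proj₁ t)))
                     (proj₂ (proj₂ t))))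

  W : Setoid 0ℓ 0ℓ
  W = record
    { Carrier = Σ[ w ∈ W₀ ] 𝒲 w w
    ; _≈_ = λ u u' → 𝒲 (proj₁ u) (proj₁ u')
    ; isEquivalence = record
      { refl = λ {u} → proj₂ u
      ; sym = 𝒲-sym
      ; trans = 𝒲-trans
      }
    }

  W-Carrier : Set
  W-Carrier = Setoid.Carrier W

  nW : W-Carrier → A₀
  nW u = n (proj₁ u)

  bW : (u : W-Carrier) → Func (Fam (nW u)) W
  bW u = record
    { to = λ x → b (proj₁ u) x , 𝒲-br (proj₂ u) x x (tr-loop (n▷ (proj₂ u)) x)
    ; cong = λ {x} {x'} e → 𝒲-br (proj₂ u) x x' (Setoid.trans (Fam (nW u)) (tr-loop (n▷ (proj₂ u)) x) e)
    }

  ImS : W-Carrier → Setoid 0ℓ 0ℓ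
  ImS u = record
    { Carrier = B₀ (nW u)
    ; _≈_ = λ s s' → Setoid._≈_ W (Func.to (bW u) s) (Func.to (bW u) s')
    ; isEquivalence = record
      { refl = λ {s} → Setoid.refl W {Func.to (bW u) s}
      ; sym = 𝒲-sym
      ; trans = 𝒲-trans
      }
    }

  ImS-tr : {u u' : W-Carrier} → Setoid._≈_ W u u' → Func (ImS u) (ImS u')
  ImS-tr {u} {u'} γ = record
    { to = Func.to (tr (n▷ γ))
    ; cong = λ {s} {s'} σ →
        𝒲-trans (𝒲-sym (g s)) (𝒲-trans σ (g s'))
    }
    where
      g : (s : B₀ (nW u)) → 𝒲 (b (proj₁ u) s) (b (proj₁ u') (Func.to (tr (n▷ γ)) s))
      g s = 𝒲-br γ s _ (Setoid.refl (Fam (nW u')))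

  e : (u : W-Carrier) → Func (Fam (nW u)) (ImS u)
  e u = record { to = λ x → x ; cong = Func.cong (bW u) }

module Recursion {A : Setoid 0ℓ 0ℓ} (B : SetoidFamily A)
                 (C : Setoid 0ℓ 0ℓ) (aC : Func (P B C) C) where
  open WConstruction B public
  open SetoidFamily B

  -- (underlying type of) the setoid CohMaps w
  CohMaps : W-Carrier → Set
  CohMaps u =
    Σ[ F ∈ ((s : Setoid.Carrier (ImS u)) → Func (ImS (Func.to (bW u) s)) C) ]
      ((s s' : Setoid.Carrier (ImS u))
       (σ : Setoid._≈_ W (Func.to (bW u) s) (Func.to (bW u) s')) →
       F s ≈→ (F s' ∘F ImS-tr {Func.to (bW u) s} {Func.to (bW u) s'} σ))

  recst : (u : W-Carrier) → CohMaps u → Func (ImS u) C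
  recst u (F , coh) = record
    { to = λ s → Func.to aC (nW (Func.to (bW u) s) , (F s ∘F e (Func.to (bW u) s)))
    ; cong = λ {s} {s'} σ → Func.cong aC (n▷ σ , coh s s' σ)
    }

  data RecDef : (u : W-Carrier) → Func (ImS u) C → Set where
    recdef : {u : W-Carrier} {k : Func (ImS u) C} (F : CohMaps u) →
             k ≈→ recst u F →
             ((s : B₀ (nW u)) → RecDef (Func.to (bW u) s) (proj₁ F s)) →
             RecDef u k

module Submission where

-- A proof of RecDef w k exhibits k as recst w F for coherent maps F
-- whose components F s are themselves witnessed by RecDef at the subtrees
-- b w s.  Comparing two such witnesses by induction on RecDef, the values
-- k s and k' s are both a_C applied to a label and a map out of the branches;
-- the labels agree and the maps agree by the induction hypothesis, so a_C
-- being extensional gives k s ≈ k' s.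
--
-- The induction only goes through if we allow the two roots to be different
-- but equal elements u ≈ u' of W, compared along the transport ImS_γ, since
-- the subtrees b u s and b u' s' are only related by a proof of equality.

open import Defs
open import Level using (0ℓ)
open import Relation.Binary.Bundles using (Setoid)
open import Function.Bundles using (Func)
open import Data.Product using (_,_; proj₁; proj₂)
import Relation.Binary.Reasoning.Setoid as SetoidReasoning

module Uniqueness {A : Setoid 0ℓ 0ℓ} (B : SetoidFamily A)
                  (C : Setoid 0ℓ 0ℓ) (aC : Func (P B C) C) where
  open Recursion B C aC
  open SetoidFamily B using (Fam; tr-loop)
  open Setoid W using () renaming (_≈_ to _≈W_)
  open SetoidReasoning C

  branch-≈ : {u u' : W-Carrier} (γ : u ≈W u') (s : Setoid.Carrier (ImS u)) →
             Func.to (bW u) s ≈W Func.to (bW u') (Func.to (ImS-tr {u} {u'} γ) s)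
  branch-≈ {u' = u'} γ s = 𝒲-br γ s _ (Setoid.refl (Fam (nW u')))

  branch-tr : {u u' : W-Carrier} (γ : u ≈W u') (s : Setoid.Carrier (ImS u)) →
              Func (ImS (Func.to (bW u) s)) (ImS (Func.to (bW u') (Func.to (ImS-tr {u} {u'} γ) s)))
  branch-tr {u} {u'} γ s =
    ImS-tr {Func.to (bW u) s} {Func.to (bW u') (Func.to (ImS-tr {u} {u'} γ) s)} (branch-≈ {u} {u'} γ s)

  ImS-tr-refl : (u : W-Carrier) (s : Setoid.Carrier (ImS u)) →
                Setoid._≈_ (ImS u) (Func.to (ImS-tr {u} {u} (Setoid.refl W {u})) s) s
  ImS-tr-refl u s = Func.cong (e u) (tr-loop (n▷ (proj₂ u)) s)

  recst-along : {u u' : W-Carrier} (γ : u ≈W u') (F : CohMaps u) (F' : CohMaps u') →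
                ((s : Setoid.Carrier (ImS u)) →
                  proj₁ F s ≈→ (proj₁ F' (Func.to (ImS-tr {u} {u'} γ) s) ∘F branch-tr {u} {u'} γ s)) →
                recst u F ≈→ (recst u' F' ∘F ImS-tr {u} {u'} γ)
  recst-along {u} {u'} γ F F' agree s = Func.cong aC (n▷ (branch-≈ {u} {u'} γ s) , agree s)

  RecDef-unique-along : {u u' : W-Carrier} (γ : u ≈W u')
                        {k : Func (ImS u) C} {k' : Func (ImS u') C} →
                        RecDef u k → RecDef u' k' → k ≈→ (k' ∘F ImS-tr {u} {u'} γ)
  RecDef-unique-along {u} {u'} γ {k} {k'} (recdef F k≈ subs) (recdef F' k'≈ subs') s =
    begin
      Func.to k s              ≈⟨ k≈ s ⟩
      Func.to (recst u F) s    ≈⟨ recst-along {u} {u'} γ F F' branches s ⟩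
      Func.to (recst u' F') s' ≈⟨ k'≈ s' ⟨
      Func.to k' s'
    ∎
    where
      transport : Func (ImS u) (ImS u')
      transport = ImS-tr {u} {u'} γ

      s' : Setoid.Carrier (ImS u')
      s' = Func.to transport s

      branches : (t : Setoid.Carrier (ImS u)) →
                 proj₁ F t ≈→ (proj₁ F' (Func.to transport t) ∘F branch-tr {u} {u'} γ t)
      branches t = RecDef-unique-along (branch-≈ {u} {u'} γ t) (subs t) (subs' (Func.to transport t))

lemma3p11 : (A : Setoid 0ℓ 0ℓ) (B : SetoidFamily A) (C : Setoid 0ℓ 0ℓ)
            (aC : Func (P B C) C) →
            let open Recursion B C aC in
            (w : W-Carrier) (k k' : Func (ImS w) C) →
            RecDef w k → RecDef w k' → k ≈→ k'
lemma3p11 A B C aC w k k' r r' s =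
  begin
    Func.to k s                                                 ≈⟨ RecDef-unique-along {w} {w} (Setoid.refl W {w}) r r' s ⟩
    Func.to k' (Func.to (ImS-tr {w} {w} (Setoid.refl W {w})) s)   ≈⟨ Func.cong k' (ImS-tr-refl w s) ⟩
    Func.to k' s
  ∎
  where
    open Recursion B C aC
    open Uniqueness B C aC
    open SetoidReasoning C
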